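{- Let $F=(k_F)_{k\ge 0}$ be a sequence of positive integers and let $\Pi$ be the $F$-cobweb poset, with levels $\Phi_0,\Phi_1,\Phi_2,\dots$ and $|\Phi_k|=k_F$. Let $\mu$ be the Möbius function of $\Pi$. Then for all $r,s\in\mathbb{N}\cup\{0\}$, all $x\in\Phi_r$ and all $y\in\Phi_s$ with $x\le y$, the value $\mu(x,y)$ depends only on $r$ and $s$, and $$\mu(x,y)=c_{r,s}=[s=r]-[s=r+1]+[s>r+1]\,(-1)^{s-r}\prod_{i=r+1}^{s-1}(i_F-1).$$
   Context: An $F$-cobweb poset is a partially ordered set $\Pi=(\Phi,\le)$ whose ground set is the disjoint union $\Phi=\bigcup_{k\ge 0}\Phi_k$ of finite nonempty sets (levels) with $|\Phi_k|=k_F$, in which each level is an antichain and, for $x\in\Phi_r$, $y\in\Phi_s$ with $r\neq s$, one has $x<y$ if and only if $r<s$. (Equivalently, $\Pi$ is the ordinal sum $\Phi_0\oplus\Phi_1\oplus\Phi_2\oplus\cdots$ of trivially ordered sets.) The Möbius function is defined recursively by $\mu(x,x)=1$ and $\mu(x,y)=-\sum_{x\le z<y}\mu(x,z)$ for $x<y$. Here $[P]$ denotes $1$ if the statement $P$ is true and $0$ otherwise. -}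

module Defs where

open import Data.Nat as ℕ using (ℕ; zero; suc; _<_; _<?_)
import Data.Nat.Properties as ℕP
open import Data.Fin using (Fin)
import Data.Fin.Properties as FinP
open import Data.Integer as ℤ using (ℤ; +_; -_; _-_)
open import Data.Product using (Σ; _,_; proj₁; proj₂; _×_)
open import Data.Product.Properties using (≡-dec)
open import Data.Sum using (_⊎_; inj₁; inj₂)
open import Data.Bool using (Bool; true; false; if_then_else_; _∧_)
open import Relation.Nullary using (Dec; yes; no; ¬_)
open import Relation.Nullary.Decidable using (⌊_⌋; _⊎-dec_; _×-dec_)
open import Relation.Binary.PropositionalEquality using (_≡_)

-- Ground set of the F-cobweb poset: disjoint union of levels Φ_k ≅ Fin (F k).
Elem : (ℕ → ℕ) → Set
Elem F = Σ ℕ (λ k → Fin (F k))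

level : {F : ℕ → ℕ} → Elem F → ℕ
level = proj₁

-- Partial order: x ≤ y iff x = y, or level x < level y
-- (levels are antichains; elements of different levels compare by level).
Le : (F : ℕ → ℕ) → Elem F → Elem F → Set
Le F x y = (x ≡ y) ⊎ (level {F} x < level {F} y)

Lt : (F : ℕ → ℕ) → Elem F → Elem F → Set
Lt F x y = Le F x y × ¬ (x ≡ y)

_≟E_ : {F : ℕ → ℕ} → (x y : Elem F) → Dec (x ≡ y)
_≟E_ = ≡-dec ℕP._≟_ FinP._≟_

≤?E : (F : ℕ → ℕ) → (x y : Elem F) → Dec (Le F x y)
≤?E F x y = (x ≟E y) ⊎-dec (proj₁ x <? proj₁ y)

<?E : (F : ℕ → ℕ) → (x y : Elem F) → Dec (Lt F x y)
<?E F x y = ≤?E F x y ×-dec Relation.Nullary.¬? (x ≟E y)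
  where import Relation.Nullary

[_] : {A : Set} → Dec A → ℤ
[ d ] = if ⌊ d ⌋ then + 1 else + 0

sumBelow : ℕ → (ℕ → ℤ) → ℤ
sumBelow zero f = + 0
sumBelow (suc n) f = sumBelow n f ℤ.+ f n

sumFin : (m : ℕ) → (Fin m → ℤ) → ℤ
sumFin zero f = + 0
sumFin (suc m) f = f Fin.zero ℤ.+ sumFin m (λ k → f (Fin.suc k))
  where import Data.Fin as Fin

sumElemsBelow : (F : ℕ → ℕ) → ℕ → (Elem F → ℤ) → ℤ
sumElemsBelow F n g = sumBelow n (λ t → sumFin (F t) (λ k → g (t , k)))

-- Möbius function, with fuel (fuel ≥ level y suffices, since every z < y has
-- level z < level y):  μ(x,x) = 1,  μ(x,y) = - Σ_{x ≤ z < y} μ(x,z) for x < y,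
-- and (conventionally) 0 when x ≰ y.
mobiusFuel : (F : ℕ → ℕ) → ℕ → Elem F → Elem F → ℤ
mobiusFuel F zero x y = [ x ≟E y ]
mobiusFuel F (suc n) x y with x ≟E y | ≤?E F x y
... | yes _ | _ = + 1
... | no _ | no _ = + 0
... | no _ | yes _ =
  - sumElemsBelow F (suc n)
      (λ z → if ⌊ ≤?E F x z ⌋ ∧ ⌊ <?E F z y ⌋ then mobiusFuel F n x z else + 0)

μ : (F : ℕ → ℕ) → Elem F → Elem F → ℤ
μ F x y = mobiusFuel F (level {F} y) x y

-- ∏_{i=a}^{b} g i  (empty product = 1 if b < a); here as ∏_{i=a}^{a+len-1}
prodFrom : ℕ → ℕ → (ℕ → ℤ) → ℤ
prodFrom a zero g = + 1
prodFrom a (suc len) g = g a ℤ.* prodFrom (suc a) len g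

c : (F : ℕ → ℕ) → ℕ → ℕ → ℤ
c F r s =
  ([ s ℕP.≟ r ] - [ s ℕP.≟ suc r ])
  ℤ.+ [ suc r <? s ]
      ℤ.* ((- + 1) ℤ.^ (s ℕ.∸ r)
           ℤ.* prodFrom (suc r) (s ℕ.∸ suc r) (λ i → + F i - + 1))

module Submission where

-- Fix x ∈ Φ_r.  We show μ(x,y) = c(r,s) for every y ∈ Φ_s with x ≤ y by
-- strong induction on the level s (formally: on the fuel of mobiusFuel).
-- For s = r we have y = x and both sides are 1.  For s > r the recursion
-- gives μ(x,y) = -Σ_{x ≤ z < y} μ(x,z); the elements z with x ≤ z < y are
-- exactly those with x ≤ z and level z < s, and by induction μ(x,z) = c(r,t)
-- for z ∈ Φ_t.  Grouping by levels, level t contributes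
--   0 (t < r),   1 (t = r, only z = x),   t_F · c(r,t) (r < t),
-- and the closed form of c satisfies c(r,r+1) = -1 and, for r < s, the
-- recurrence c(r,s+1) = -c(r,s)·(s_F - 1).  Together these give
-- Σ_{t<s} (contribution of level t) = -c(r,s) for all s > r, which closes
-- the induction.

open import Defs
open import Data.Nat as ℕ using (ℕ; zero; suc; _<_; _≤_; z≤n; s≤s; _<?_)
import Data.Nat.Properties as ℕP
open import Data.Fin using (Fin)
import Data.Fin as Fin using (zero; suc)
import Data.Fin.Properties as FinP
open import Data.Integer as ℤ using (ℤ; +_; -_; _-_)
import Data.Integer.Properties as ℤP
open import Data.Integer.Tactic.RingSolver using (solve-∀)
open import Data.Product using (∃; _,_; proj₁)
open import Data.Sum using (inj₁; inj₂)
open import Data.Bool using (if_then_else_; _∧_)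
open import Relation.Nullary using (Dec; yes; no; ¬_)
open import Relation.Nullary.Decidable using (⌊_⌋)
open import Relation.Binary.PropositionalEquality hiding ([_])
open import Data.Empty using (⊥-elim)
open import Function using (_∘_)

iverson-yes : {A : Set} (d : Dec A) → A → [ d ] ≡ + 1
iverson-yes (yes _) _ = refl
iverson-yes (no ¬a) a = ⊥-elim (¬a a)

iverson-no : {A : Set} (d : Dec A) → ¬ A → [ d ] ≡ + 0
iverson-no (yes a) ¬a = ⊥-elim (¬a a)
iverson-no (no _) _ = refl

if-yes : {A B : Set} (d : Dec A) {a b : B} → A → (if ⌊ d ⌋ then a else b) ≡ a
if-yes (yes _) _ = refl
if-yes (no ¬a) a = ⊥-elim (¬a a)

if-no : {A B : Set} (d : Dec A) {a b : B} → ¬ A → (if ⌊ d ⌋ then a else b) ≡ b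
if-no (yes a) ¬a = ⊥-elim (¬a a)
if-no (no _) _ = refl

sumFin-ext : ∀ m (f h : Fin m → ℤ) → (∀ k → f k ≡ h k) → sumFin m f ≡ sumFin m h
sumFin-ext zero f h e = refl
sumFin-ext (suc m) f h e = cong₂ ℤ._+_ (e Fin.zero) (sumFin-ext m _ _ (λ k → e (Fin.suc k)))

sumFin-const : ∀ m (f : Fin m → ℤ) v → (∀ k → f k ≡ v) → sumFin m f ≡ + m ℤ.* v
sumFin-const zero f v h = refl
sumFin-const (suc m) f v h = begin
  f Fin.zero ℤ.+ sumFin m (λ k → f (Fin.suc k))
    ≡⟨ cong₂ ℤ._+_ (h Fin.zero) (sumFin-const m _ v (λ k → h (Fin.suc k))) ⟩
  v ℤ.+ + m ℤ.* v
    ≡⟨ cong (ℤ._+ (+ m ℤ.* v)) (sym (ℤP.*-identityˡ v)) ⟩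
  + 1 ℤ.* v ℤ.+ + m ℤ.* v
    ≡⟨ sym (ℤP.*-distribʳ-+ v (+ 1) (+ m)) ⟩
  + suc m ℤ.* v ∎
  where open ≡-Reasoning

sumFin-zero : ∀ m (f : Fin m → ℤ) → (∀ k → f k ≡ + 0) → sumFin m f ≡ + 0
sumFin-zero m f h = trans (sumFin-const m f (+ 0) h) (ℤP.*-zeroʳ (+ m))

sumFin-delta : ∀ m (a : Fin m) (f : Fin m → ℤ) → (∀ k → ¬ k ≡ a → f k ≡ + 0) →
  sumFin m f ≡ f a
sumFin-delta (suc m) Fin.zero f h =
  trans (cong (λ u → f Fin.zero ℤ.+ u) (sumFin-zero m _ (λ k → h (Fin.suc k) (λ ()))))
        (ℤP.+-identityʳ _)
sumFin-delta (suc m) (Fin.suc a) f h =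
  trans (cong₂ ℤ._+_ (h Fin.zero (λ ()))
                     (sumFin-delta m a _ (λ k k≢a → h (Fin.suc k) (k≢a ∘ FinP.suc-injective))))
        (ℤP.+-identityˡ _)

sumBelow-ext : ∀ n (f h : ℕ → ℤ) → (∀ t → t < n → f t ≡ h t) → sumBelow n f ≡ sumBelow n h
sumBelow-ext zero f h e = refl
sumBelow-ext (suc n) f h e =
  cong₂ ℤ._+_ (sumBelow-ext n f h (λ t t<n → e t (ℕP.m≤n⇒m≤1+n t<n))) (e n ℕP.≤-refl)

sumBelow-zero : ∀ n (f : ℕ → ℤ) → (∀ t → t < n → f t ≡ + 0) → sumBelow n f ≡ + 0
sumBelow-zero zero f h = refl
sumBelow-zero (suc n) f h =
  cong₂ ℤ._+_ (sumBelow-zero n f (λ t t<n → h t (ℕP.m≤n⇒m≤1+n t<n))) (h n ℕP.≤-refl)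

sumBelow-tail : ∀ n s (f : ℕ → ℤ) → s ≤ n → (∀ t → s ≤ t → f t ≡ + 0) →
  sumBelow n f ≡ sumBelow s f
sumBelow-tail zero zero f _ _ = refl
sumBelow-tail (suc n) s f s≤1+n h with ℕP.m≤n⇒m<n∨m≡n s≤1+n
... | inj₂ refl = refl
... | inj₁ (s≤s s≤n) =
  trans (cong₂ ℤ._+_ (sumBelow-tail n s f s≤n h) (h n s≤n)) (ℤP.+-identityʳ _)

prodFrom-snoc : ∀ a len (g : ℕ → ℤ) →
  prodFrom a (suc len) g ≡ prodFrom a len g ℤ.* g (len ℕ.+ a)
prodFrom-snoc a zero g = trans (ℤP.*-identityʳ _) (sym (ℤP.*-identityˡ _))
prodFrom-snoc a (suc len) g = begin
  g a ℤ.* prodFrom (suc a) (suc len) g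
    ≡⟨ cong (g a ℤ.*_) (prodFrom-snoc (suc a) len g) ⟩
  g a ℤ.* (prodFrom (suc a) len g ℤ.* g (len ℕ.+ suc a))
    ≡⟨ sym (ℤP.*-assoc (g a) _ _) ⟩
  g a ℤ.* prodFrom (suc a) len g ℤ.* g (len ℕ.+ suc a)
    ≡⟨ cong (λ i → g a ℤ.* prodFrom (suc a) len g ℤ.* g i) (ℕP.+-suc len a) ⟩
  g a ℤ.* prodFrom (suc a) len g ℤ.* g (suc len ℕ.+ a) ∎
  where open ≡-Reasoning

above-view : ∀ {r s} → r < s → ∃ λ d → s ≡ suc d ℕ.+ r
above-view {r} {s} r<s =
  s ℕ.∸ suc r , sym (trans (sym (ℕP.+-suc (s ℕ.∸ suc r) r)) (ℕP.m∸n+n≡m r<s))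

module _ (F : ℕ → ℕ) where

  factor : ℕ → ℤ
  factor i = + F i - + 1

  c-diag : ∀ r → c F r r ≡ + 1
  c-diag r
    rewrite iverson-yes (r ℕP.≟ r) refl
          | iverson-no (r ℕP.≟ suc r) (ℕP.<⇒≢ (ℕP.n<1+n r))
          | iverson-no (suc r <? r) (ℕP.≤⇒≯ (ℕP.n≤1+n r))
          = refl

  c-next : ∀ r → c F r (suc r) ≡ - + 1
  c-next r
    rewrite iverson-no (suc r ℕP.≟ r) ℕP.1+n≢n
          | iverson-yes (suc r ℕP.≟ suc r) refl
          | iverson-no (suc r <? suc r) (ℕP.n≮n (suc r))
          = refl

  c-closed : ∀ r d → c F r (suc d ℕ.+ r) ≡ (- + 1) ℤ.^ suc d ℤ.* prodFrom (suc r) d factor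
  c-closed r zero = c-next r
  c-closed r (suc d)
    rewrite iverson-no (suc (suc (d ℕ.+ r)) ℕP.≟ r)
                       (ℕP.>⇒≢ (s≤s (ℕP.m≤n+m r (suc d))))
          | iverson-no (suc (suc (d ℕ.+ r)) ℕP.≟ suc r)
                       (ℕP.>⇒≢ (s≤s (s≤s (ℕP.m≤n+m r d))))
          | iverson-yes (suc r <? suc (suc (d ℕ.+ r))) (s≤s (s≤s (ℕP.m≤n+m r d)))
          | ℕP.m+n∸n≡m (suc (suc d)) r
          | ℕP.m+n∸n≡m (suc d) r
          = trans (ℤP.+-identityˡ _) (ℤP.*-identityˡ _)

  c-recurrence : ∀ {r s} → r < s → c F r (suc s) ≡ - (c F r s ℤ.* factor s)
  c-recurrence {r} r<s with above-view r<s
  ... | d , refl = begin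
      c F r (suc (suc d) ℕ.+ r)
        ≡⟨ c-closed r (suc d) ⟩
      sign ℤ.^ suc (suc d) ℤ.* prodFrom (suc r) (suc d) factor
        ≡⟨ cong (sign ℤ.^ suc (suc d) ℤ.*_) (prodFrom-snoc (suc r) d factor) ⟩
      sign ℤ.^ suc (suc d) ℤ.* (prodFrom (suc r) d factor ℤ.* factor (d ℕ.+ suc r))
        ≡⟨ cong (λ i → sign ℤ.^ suc (suc d) ℤ.* (prodFrom (suc r) d factor ℤ.* factor i))
                (ℕP.+-suc d r) ⟩
      sign ℤ.* sign ℤ.^ suc d ℤ.* (prodFrom (suc r) d factor ℤ.* factor (suc d ℕ.+ r))
        ≡⟨ sign-shift (sign ℤ.^ suc d) _ _ ⟩
      - (sign ℤ.^ suc d ℤ.* prodFrom (suc r) d factor ℤ.* factor (suc d ℕ.+ r))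
        ≡⟨ cong (λ u → - (u ℤ.* factor (suc d ℕ.+ r))) (sym (c-closed r d)) ⟩
      - (c F r (suc d ℕ.+ r) ℤ.* factor (suc d ℕ.+ r)) ∎
    where
      open ≡-Reasoning
      sign : ℤ
      sign = - + 1
      sign-shift : ∀ X P G → (- + 1 ℤ.* X) ℤ.* (P ℤ.* G) ≡ - ((X ℤ.* P) ℤ.* G)
      sign-shift = solve-∀

  module FromElement (r : ℕ) (a : Fin (F r)) where

    x : Elem F
    x = r , a

    levelSum : ℕ → ℤ
    levelSum t = sumFin (F t) (λ k → if ⌊ ≤?E F x (t , k) ⌋ then c F r t else + 0)

    levelSum-below : ∀ t → t < r → levelSum t ≡ + 0
    levelSum-below t t<r = sumFin-zero (F t) _ λ k → if-no (≤?E F x (t , k)) λ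
      { (inj₁ refl) → ℕP.<-irrefl refl t<r
      ; (inj₂ r<t) → ℕP.<-asym r<t t<r }

    -- Within Φ_r only x itself lies above x.
    levelSum-at : levelSum r ≡ + 1
    levelSum-at = begin
      levelSum r
        ≡⟨ sumFin-delta (F r) a _ (λ k k≢a → if-no (≤?E F x (r , k)) λ
             { (inj₁ refl) → k≢a refl
             ; (inj₂ r<r) → ℕP.<-irrefl refl r<r }) ⟩
      (if ⌊ ≤?E F x x ⌋ then c F r r else + 0)
        ≡⟨ if-yes (≤?E F x x) (inj₁ refl) ⟩
      c F r r
        ≡⟨ c-diag r ⟩
      + 1 ∎
      where open ≡-Reasoning

    levelSum-above : ∀ t → r < t → levelSum t ≡ + F t ℤ.* c F r t
    levelSum-above t r<t = sumFin-const (F t) _ _ (λ k → if-yes (≤?E F x (t , k)) (inj₂ r<t))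

    partial-levelSum : ∀ s → r < s → sumBelow s levelSum ≡ - c F r s
    partial-levelSum (suc s) (s≤s r≤s) with ℕP.m≤n⇒m<n∨m≡n r≤s
    ... | inj₂ refl = trans (cong₂ ℤ._+_ (sumBelow-zero r levelSum levelSum-below) levelSum-at)
                            (sym (cong -_ (c-next r)))
    ... | inj₁ r<s = begin
      sumBelow s levelSum ℤ.+ levelSum s
        ≡⟨ cong₂ ℤ._+_ (partial-levelSum s r<s) (levelSum-above s r<s) ⟩
      - c F r s ℤ.+ + F s ℤ.* c F r s
        ≡⟨ collect (c F r s) (+ F s) ⟩
      c F r s ℤ.* factor s
        ≡⟨ sym (ℤP.neg-involutive _) ⟩
      - - (c F r s ℤ.* factor s)
        ≡⟨ cong -_ (sym (c-recurrence r<s)) ⟩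
      - c F r (suc s) ∎
      where
        open ≡-Reasoning
        collect : ∀ C N → - C ℤ.+ N ℤ.* C ≡ C ℤ.* (N - + 1)
        collect = solve-∀

    intervalTerm : ℕ → Elem F → Elem F → ℤ
    intervalTerm n y z =
      if ⌊ ≤?E F x z ⌋ ∧ ⌊ <?E F z y ⌋ then mobiusFuel F n x z else + 0

    intervalSum : ∀ n s (b : Fin (F s)) →
      (∀ z → level {F} z ≤ n → Le F x z → mobiusFuel F n x z ≡ c F r (level {F} z)) →
      s ≤ suc n →
      sumElemsBelow F (suc n) (intervalTerm n (s , b)) ≡ sumBelow s levelSum
    intervalSum n s b IH s≤1+n =
      trans (sumBelow-tail (suc n) s _ s≤1+n
               (λ t s≤t → sumFin-zero (F t) _ (λ k → term-above t k s≤t)))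
            (sumBelow-ext s _ _
               (λ t t<s → sumFin-ext (F t) _ _ (λ k → term-below t k t<s)))
      where
        y : Elem F
        y = s , b

        -- No z at level ≥ s lies below y.
        term-above : ∀ t k → s ≤ t → intervalTerm n y (t , k) ≡ + 0
        term-above t k s≤t with ≤?E F x (t , k) | <?E F (t , k) y
        ... | no _ | _ = refl
        ... | yes _ | no _ = refl
        ... | yes _ | yes (inj₁ z≡y , z≢y) = ⊥-elim (z≢y z≡y)
        ... | yes _ | yes (inj₂ t<s , _) = ⊥-elim (ℕP.≤⇒≯ s≤t t<s)

        -- Every z at level < s lies below y, and there μ(x,z) = c(r,t).
        term-below : ∀ t k → t < s →
          intervalTerm n y (t , k) ≡ (if ⌊ ≤?E F x (t , k) ⌋ then c F r t else + 0)
        term-below t k t<s with ≤?E F x (t , k) | <?E F (t , k) y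
        ... | no _ | _ = refl
        ... | yes x≤z | yes _ = IH (t , k) (ℕP.≤-pred (ℕP.<-≤-trans t<s s≤1+n)) x≤z
        ... | yes _ | no z≮y = ⊥-elim (z≮y (inj₂ t<s , λ z≡y → ℕP.<-irrefl (cong proj₁ z≡y) t<s))

  mobiusFuel-closed : ∀ n (x y : Elem F) → level {F} y ≤ n → Le F x y →
    mobiusFuel F n x y ≡ c F (level {F} x) (level {F} y)
  mobiusFuel-closed zero (r , a) _ _ (inj₁ refl) =
    trans (iverson-yes ((r , a) ≟E (r , a)) refl) (sym (c-diag r))
  mobiusFuel-closed zero _ _ z≤n (inj₂ ())
  mobiusFuel-closed (suc n) (r , a) (s , b) s≤1+n x≤y
    with (r , a) ≟E (s , b) | ≤?E F (r , a) (s , b)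
  ... | yes refl | _ = sym (c-diag r)
  ... | no _ | no x≰y = ⊥-elim (x≰y x≤y)
  ... | no x≢y | yes _ with x≤y
  ...   | inj₁ x≡y = ⊥-elim (x≢y x≡y)
  ...   | inj₂ r<s = begin
      - sumElemsBelow F (suc n) (intervalTerm n (s , b))
        ≡⟨ cong -_ (intervalSum n s b (λ z z≤n x≤z → mobiusFuel-closed n (r , a) z z≤n x≤z) s≤1+n) ⟩
      - sumBelow s levelSum
        ≡⟨ cong -_ (partial-levelSum s r<s) ⟩
      - - c F r s
        ≡⟨ ℤP.neg-involutive _ ⟩
      c F r s ∎
    where
      open ≡-Reasoning
      open FromElement r a

theorem3 : (F : ℕ → ℕ) → (∀ k → 0 < F k) →
    (r s : ℕ) (x : Fin (F r)) (y : Fin (F s)) →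
    Le F (r , x) (s , y) →
    μ F (r , x) (s , y) ≡ c F r s
theorem3 F _ r s x y x≤y = mobiusFuel-closed F s (r , x) (s , y) ℕP.≤-refl x≤y
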